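{- Let $\phi$ be a Drinfeld module over $A=\mathbb{F}_q[\theta]$ and $a\in A$. Let $P$ be an irreducible polynomial such that $\phi_P(a)$ is irreducible. Then either $a$ is irreducible and $a\in\phi(A)_{\mathrm{Tors}}$, or $a\in\mathbb{F}_q^\times$.
   Context: Let $q$ be a power of a prime $p$, $A=\mathbb{F}_q[\theta]$. Let $A\{\tau\}$ be the ring of twisted polynomials $\sum_i b_i\tau^i$ ($b_i\in A$) with $\tau b=b^q\tau$. A Drinfeld module of rank $r\geq1$ is an $\mathbb{F}_q$-algebra homomorphism $\phi:A\to A\{\tau\}$, $b\mapsto\phi_b$, with $\phi_\theta=\theta+\sum_{i=1}^r a_i\tau^i$, $a_i\in A$, $a_r\neq0$; for $\phi_b=\sum_i c_i\tau^i$ and $x\in A$, $\phi_b(x)=\sum_i c_ix^{q^i}$. The torsion set is $\phi(A)_{\mathrm{Tors}}=\{x\in A:\exists c\in A\setminus\{0\},\ \phi_c(x)=0\}$. "Irreducible" does not require monic. -}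

module Defs where

open import Level using (Level)
open import Data.Nat as ℕ using (ℕ; zero; suc)
open import Data.Nat.Primality using (Prime)
open import Data.Fin using (Fin)
open import Data.List using (List; []; _∷_)
open import Data.Product using (Σ; ∃; _×_; _,_)
open import Data.Sum using (_⊎_)
open import Relation.Binary.PropositionalEquality using (_≡_; _≢_)
open import Relation.Nullary using (¬_)
open import Function.Bundles using (_↔_)
open import Algebra.Structures using (IsCommutativeRing)

record FiniteField (ℓ : Level) : Set (Level.suc ℓ) where
  infixl 7 _*_
  infixl 6 _+_
  field
    Carrier : Set ℓ
    _+_ _*_ : Carrier → Carrier → Carrier
    -_      : Carrier → Carrier
    0# 1#   : Carrier
    isCommutativeRing : IsCommutativeRing _≡_ _+_ _*_ -_ 0# 1#
    0≢1     : 0# ≢ 1#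
    inverse : ∀ x → x ≢ 0# → Σ Carrier (λ y → x * y ≡ 1#)
    p k q   : ℕ
    p-prime : Prime p
    k≥1     : 1 ℕ.≤ k
    q≡p^k   : q ≡ p ℕ.^ k
    finite  : Carrier ↔ Fin q

-- A = F_q[θ]: polynomials as coefficient lists (lowest degree first),
-- compared up to trailing zeros (coefficientwise equality).

module Poly {ℓ : Level} (F : FiniteField ℓ) where
  open FiniteField F

  A : Set ℓ
  A = List Carrier

  coeff : A → ℕ → Carrier
  coeff []       _       = 0#
  coeff (c ∷ f)  zero    = c
  coeff (c ∷ f)  (suc n) = coeff f n

  infix 4 _≈ₚ_
  _≈ₚ_ : A → A → Set ℓ
  f ≈ₚ g = ∀ n → coeff f n ≡ coeff g n

  0ₚ 1ₚ θ : A
  0ₚ = []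
  1ₚ = 1# ∷ []
  θ  = 0# ∷ 1# ∷ []

  const : Carrier → A
  const c = c ∷ []

  infixl 6 _+ₚ_
  _+ₚ_ : A → A → A
  []      +ₚ g       = g
  (c ∷ f) +ₚ []      = c ∷ f
  (c ∷ f) +ₚ (d ∷ g) = (c + d) ∷ (f +ₚ g)

  infixr 7 _•_
  _•_ : Carrier → A → A
  c • []      = []
  c • (d ∷ f) = (c * d) ∷ (c • f)

  infixl 7 _*ₚ_
  _*ₚ_ : A → A → A
  []      *ₚ g = []
  (c ∷ f) *ₚ g = (c • g) +ₚ (0# ∷ (f *ₚ g))

  infixr 8 _^ₚ_
  _^ₚ_ : A → ℕ → A
  f ^ₚ zero  = 1ₚ
  f ^ₚ suc n = f *ₚ (f ^ₚ n)

  IsUnit : A → Set ℓ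
  IsUnit f = Σ A (λ g → f *ₚ g ≈ₚ 1ₚ)

  Irreducible : A → Set ℓ
  Irreducible f = (¬ (f ≈ₚ 0ₚ)) × (¬ IsUnit f)
                × (∀ g h → f ≈ₚ g *ₚ h → IsUnit g ⊎ IsUnit h)

  InFqˣ : A → Set ℓ
  InFqˣ f = Σ Carrier (λ c → (c ≢ 0#) × (f ≈ₚ const c))

  -- Drinfeld modules of rank r ≥ 1:
  --   φ_θ = θ + Σ_{i=1}^r a_i τ^i,  a_i ∈ A, a_r ≠ 0.
  -- Only the values a i for 1 ≤ i ≤ r are used.

  record DrinfeldModule : Set ℓ where
    field
      r    : ℕ
      r≥1  : 1 ℕ.≤ r
      a    : ℕ → A
      a-r≠0 : ¬ (a r ≈ₚ 0ₚ)

    tail : ℕ → A → A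
    tail zero    x = 0ₚ
    tail (suc n) x = tail n x +ₚ (a (suc n) *ₚ (x ^ₚ (q ℕ.^ suc n)))

    φθ : A → A
    φθ x = (θ *ₚ x) +ₚ tail r x

    -- φ_b(x) for b = Σ_j b_j θ^j : since φ is an F_q-algebra hom,
    -- φ_b = Σ_j b_j (φ_θ)^j, i.e. φ_{c + θ b'}(x) = c x + φ_{b'}(φ_θ(x)).
    φ : A → A → A
    φ []      x = 0ₚ
    φ (c ∷ b) x = (c • x) +ₚ φ b (φθ x)

    Torsion : A → Set ℓ
    Torsion x = Σ A (λ c → (¬ (c ≈ₚ 0ₚ)) × (φ c x ≈ₚ 0ₚ))

{-# OPTIONS --safe #-}

-- φ_θ(y) = θ y + Σ a_i y^{q^i} has no constant term in y, so x divides every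
-- φ_b(x) = Σ_j b_j φ_θ^j(x); write φ_P(x) = u x. Irreducibility of φ_P(x) makes u or x a unit,
-- and comparing leading coefficients shows that the units of F_q[θ] are the nonzero constants.
-- If u = c ∈ F_q^×, then x is an associate of φ_P(x), hence irreducible, and φ_{P - c} kills x,
-- where P - c ≠ 0 because the irreducible P is not a unit.

module Submission where

open import Defs
open import Level using (Level)
open import Data.Product using (_×_)
open import Data.Sum using (_⊎_)

open import Algebra.Bundles using (CommutativeMonoid; CommutativeSemiring)
open import Algebra.Structures using (IsCommutativeRing; IsCommutativeMonoid; IsCommutativeSemiring)
import Algebra.Structures.Biased as Biased
import Algebra.Properties.CommutativeSemigroup as CommutativeSemigroupProperties
import Algebra.Properties.Semiring.Divisibility as SemiringDivisibility
open import Data.Empty using (⊥-elim)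
open import Data.Fin.Properties using (inj⇒≟)
open import Data.List using ([]; _∷_)
open import Data.Nat as ℕ using (ℕ; zero; suc; NonZero; s≤s; z≤n)
open import Data.Nat.Primality using (prime⇒nonZero)
open import Data.Nat.Properties using (m^n≢0; m≤n+m)
open import Data.Product using (Σ; _,_; proj₁; proj₂)
open import Data.Sum using (inj₁; inj₂; map₂)
open import Function.Properties.Inverse using (↔⇒↣)
open import Relation.Binary.Bundles using (Setoid)
open import Relation.Binary.Structures using (IsEquivalence)
open import Relation.Binary.PropositionalEquality
open import Relation.Nullary using (¬_; Dec; yes; no)
import Relation.Binary.Reasoning.Setoid as SetoidReasoning

module PolynomialRing {ℓ : Level} (F : FiniteField ℓ) where
  open FiniteField F
  open Poly F
  open IsCommutativeRing isCommutativeRing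
    using ( +-assoc; +-comm; +-identityˡ; +-identityʳ; -‿inverseˡ; -‿inverseʳ
          ; *-assoc; *-comm; *-identityˡ; distribˡ; distribʳ; zeroˡ; zeroʳ)

  _≟_ : (a b : Carrier) → Dec (a ≡ b)
  _≟_ = inj⇒≟ (↔⇒↣ finite)

  *-nonZero : ∀ {a b} → a ≢ 0# → b ≢ 0# → a * b ≢ 0#
  *-nonZero {a} {b} a≢0 b≢0 ab≡0 = b≢0 (begin
      b              ≡⟨ *-identityˡ b ⟨
      1# * b         ≡⟨ cong (_* b) a⁻¹a≡1 ⟨
      (a⁻¹ * a) * b  ≡⟨ *-assoc a⁻¹ a b ⟩
      a⁻¹ * (a * b)  ≡⟨ cong (a⁻¹ *_) ab≡0 ⟩
      a⁻¹ * 0#       ≡⟨ zeroʳ a⁻¹ ⟩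
      0#             ∎)
    where
    open ≡-Reasoning
    a⁻¹ : Carrier
    a⁻¹ = proj₁ (inverse a a≢0)
    a⁻¹a≡1 : a⁻¹ * a ≡ 1#
    a⁻¹a≡1 = trans (*-comm a⁻¹ a) (proj₂ (inverse a a≢0))

  q^n-nonZero : ∀ n → NonZero (q ℕ.^ n)
  q^n-nonZero n = m^n≢0 q n {{subst NonZero (sym q≡p^k) (m^n≢0 p k {{prime⇒nonZero p-prime}})}}

  -- Unlike the function type _≈ₚ_, this record lets Agda infer both polynomials from a proof.
  infix 4 _≈_ _≉_
  record _≈_ (f g : A) : Set ℓ where
    constructor coeffwise
    field coeff-≡ : f ≈ₚ g
  open _≈_ public

  _≉_ : A → A → Set ℓ
  f ≉ g = ¬ (f ≈ g)

  ≈-isEquivalence : IsEquivalence _≈_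
  ≈-isEquivalence = record
    { refl  = coeffwise λ _ → refl
    ; sym   = λ f≈g → coeffwise λ n → sym (coeff-≡ f≈g n)
    ; trans = λ f≈g g≈h → coeffwise λ n → trans (coeff-≡ f≈g n) (coeff-≡ g≈h n)
    }

  ≈-setoid : Setoid ℓ ℓ
  ≈-setoid = record { isEquivalence = ≈-isEquivalence }

  open Setoid ≈-setoid public using () renaming (refl to ≈-refl; sym to ≈-sym; trans to ≈-trans)

  module ≈-Reasoning = SetoidReasoning ≈-setoid

  coeff-+ₚ : ∀ f g n → coeff (f +ₚ g) n ≡ coeff f n + coeff g n
  coeff-+ₚ []      g       n       = sym (+-identityˡ _)
  coeff-+ₚ (c ∷ f) []      n       = sym (+-identityʳ _)
  coeff-+ₚ (c ∷ f) (d ∷ g) zero    = refl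
  coeff-+ₚ (c ∷ f) (d ∷ g) (suc n) = coeff-+ₚ f g n

  coeff-• : ∀ c f n → coeff (c • f) n ≡ c * coeff f n
  coeff-• c []      n       = sym (zeroʳ c)
  coeff-• c (d ∷ f) zero    = refl
  coeff-• c (d ∷ f) (suc n) = coeff-• c f n

  ∷-cong : ∀ {c d f g} → c ≡ d → f ≈ g → c ∷ f ≈ d ∷ g
  ∷-cong c≡d f≈g = coeffwise λ { zero → c≡d ; (suc n) → coeff-≡ f≈g n }

  0∷0ₚ : 0# ∷ 0ₚ ≈ 0ₚ
  0∷0ₚ = coeffwise λ { zero → refl ; (suc n) → refl }

  +ₚ-cong : ∀ {f f′ g g′} → f ≈ f′ → g ≈ g′ → f +ₚ g ≈ f′ +ₚ g′
  +ₚ-cong {f} {f′} {g} {g′} f≈f′ g≈g′ = coeffwise λ n → begin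
      coeff (f +ₚ g) n          ≡⟨ coeff-+ₚ f g n ⟩
      coeff f n + coeff g n     ≡⟨ cong₂ _+_ (coeff-≡ f≈f′ n) (coeff-≡ g≈g′ n) ⟩
      coeff f′ n + coeff g′ n   ≡⟨ coeff-+ₚ f′ g′ n ⟨
      coeff (f′ +ₚ g′) n        ∎
    where open ≡-Reasoning

  +ₚ-assoc : ∀ f g h → (f +ₚ g) +ₚ h ≈ f +ₚ (g +ₚ h)
  +ₚ-assoc []      g       h       = ≈-refl
  +ₚ-assoc (c ∷ f) []      h       = ≈-refl
  +ₚ-assoc (c ∷ f) (d ∷ g) []      = ≈-refl
  +ₚ-assoc (c ∷ f) (d ∷ g) (e ∷ h) = ∷-cong (+-assoc c d e) (+ₚ-assoc f g h)

  +ₚ-comm : ∀ f g → f +ₚ g ≈ g +ₚ f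
  +ₚ-comm []      []      = ≈-refl
  +ₚ-comm []      (d ∷ g) = ≈-refl
  +ₚ-comm (c ∷ f) []      = ≈-refl
  +ₚ-comm (c ∷ f) (d ∷ g) = ∷-cong (+-comm c d) (+ₚ-comm f g)

  +ₚ-identityʳ : ∀ f → f +ₚ 0ₚ ≈ f
  +ₚ-identityʳ []      = ≈-refl
  +ₚ-identityʳ (c ∷ f) = ≈-refl

  +ₚ-isCommutativeMonoid : IsCommutativeMonoid _≈_ _+ₚ_ 0ₚ
  +ₚ-isCommutativeMonoid = Biased.IsCommutativeMonoidˡ.isCommutativeMonoid {_≈_ = _≈_} record
    { isSemigroup = record
      { isMagma = record { isEquivalence = ≈-isEquivalence ; ∙-cong = +ₚ-cong }
      ; assoc   = +ₚ-assoc
      }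
    ; identityˡ = λ _ → ≈-refl
    ; comm      = +ₚ-comm
    }

  +ₚ-commutativeMonoid : CommutativeMonoid ℓ ℓ
  +ₚ-commutativeMonoid = record { isCommutativeMonoid = +ₚ-isCommutativeMonoid }

  open CommutativeSemigroupProperties (CommutativeMonoid.commutativeSemigroup +ₚ-commutativeMonoid)
    using () renaming (interchange to +ₚ-interchange)

  0∷-+ₚ : ∀ f g → 0# ∷ (f +ₚ g) ≈ (0# ∷ f) +ₚ (0# ∷ g)
  0∷-+ₚ f g = ∷-cong (sym (+-identityʳ 0#)) ≈-refl

  •-cong : ∀ c {f g} → f ≈ g → c • f ≈ c • g
  •-cong c {f} {g} f≈g = coeffwise λ n → begin
      coeff (c • f) n   ≡⟨ coeff-• c f n ⟩
      c * coeff f n     ≡⟨ cong (c *_) (coeff-≡ f≈g n) ⟩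
      c * coeff g n     ≡⟨ coeff-• c g n ⟨
      coeff (c • g) n   ∎
    where open ≡-Reasoning

  •-distribˡ : ∀ c f g → c • (f +ₚ g) ≈ c • f +ₚ c • g
  •-distribˡ c []      g       = ≈-refl
  •-distribˡ c (d ∷ f) []      = ≈-refl
  •-distribˡ c (d ∷ f) (e ∷ g) = ∷-cong (distribˡ c d e) (•-distribˡ c f g)

  •-distribʳ : ∀ c d f → (c + d) • f ≈ c • f +ₚ d • f
  •-distribʳ c d []      = ≈-refl
  •-distribʳ c d (e ∷ f) = ∷-cong (distribʳ e c d) (•-distribʳ c d f)

  •-assoc : ∀ c d f → (c * d) • f ≈ c • (d • f)
  •-assoc c d []      = ≈-refl
  •-assoc c d (e ∷ f) = ∷-cong (*-assoc c d e) (•-assoc c d f)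

  •-zeroˡ : ∀ f → 0# • f ≈ 0ₚ
  •-zeroˡ f = coeffwise λ n → trans (coeff-• 0# f n) (zeroˡ _)

  •-identityˡ : ∀ f → 1# • f ≈ f
  •-identityˡ f = coeffwise λ n → trans (coeff-• 1# f n) (*-identityˡ _)

  •-0∷ : ∀ c f → c • (0# ∷ f) ≈ 0# ∷ (c • f)
  •-0∷ c f = ∷-cong (zeroʳ c) ≈-refl

  *ₚ-congʳ : ∀ f {g h} → g ≈ h → f *ₚ g ≈ f *ₚ h
  *ₚ-congʳ []      g≈h = ≈-refl
  *ₚ-congʳ (c ∷ f) g≈h = +ₚ-cong (•-cong c g≈h) (∷-cong refl (*ₚ-congʳ f g≈h))

  *ₚ-zeroʳ : ∀ f → f *ₚ 0ₚ ≈ 0ₚ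
  *ₚ-zeroʳ []      = ≈-refl
  *ₚ-zeroʳ (c ∷ f) = ≈-trans (∷-cong refl (*ₚ-zeroʳ f)) 0∷0ₚ

  *ₚ-const : ∀ f c → f *ₚ const c ≈ c • f
  *ₚ-const []      c = ≈-refl
  *ₚ-const (d ∷ f) c = ∷-cong (trans (+-identityʳ (d * c)) (*-comm d c)) (*ₚ-const f c)

  *ₚ-0∷ : ∀ f g → f *ₚ (0# ∷ g) ≈ 0# ∷ (f *ₚ g)
  *ₚ-0∷ []      g = ≈-sym 0∷0ₚ
  *ₚ-0∷ (c ∷ f) g = ∷-cong (trans (+-identityʳ (c * 0#)) (zeroʳ c)) (+ₚ-cong ≈-refl (*ₚ-0∷ f g))

  0∷-*ₚ : ∀ f g → (0# ∷ f) *ₚ g ≈ 0# ∷ (f *ₚ g)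
  0∷-*ₚ f g = +ₚ-cong (•-zeroˡ g) ≈-refl

  *ₚ-distribˡ : ∀ f g h → f *ₚ (g +ₚ h) ≈ f *ₚ g +ₚ f *ₚ h
  *ₚ-distribˡ []      g h = ≈-refl
  *ₚ-distribˡ (c ∷ f) g h = begin
      c • (g +ₚ h) +ₚ (0# ∷ f *ₚ (g +ₚ h))
        ≈⟨ +ₚ-cong (•-distribˡ c g h) (∷-cong refl (*ₚ-distribˡ f g h)) ⟩
      (c • g +ₚ c • h) +ₚ (0# ∷ (f *ₚ g +ₚ f *ₚ h))
        ≈⟨ +ₚ-cong ≈-refl (0∷-+ₚ (f *ₚ g) (f *ₚ h)) ⟩
      (c • g +ₚ c • h) +ₚ ((0# ∷ f *ₚ g) +ₚ (0# ∷ f *ₚ h))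
        ≈⟨ +ₚ-interchange (c • g) (c • h) (0# ∷ f *ₚ g) (0# ∷ f *ₚ h) ⟩
      (c • g +ₚ (0# ∷ f *ₚ g)) +ₚ (c • h +ₚ (0# ∷ f *ₚ h))
        ∎
    where open ≈-Reasoning

  *ₚ-comm : ∀ f g → f *ₚ g ≈ g *ₚ f
  *ₚ-comm []      g = ≈-sym (*ₚ-zeroʳ g)
  *ₚ-comm (c ∷ f) g = begin
      c • g +ₚ (0# ∷ f *ₚ g)             ≈⟨ +ₚ-cong (*ₚ-const g c) (∷-cong refl (*ₚ-comm g f)) ⟨
      g *ₚ const c +ₚ (0# ∷ g *ₚ f)      ≈⟨ +ₚ-cong ≈-refl (*ₚ-0∷ g f) ⟨
      g *ₚ const c +ₚ g *ₚ (0# ∷ f)      ≈⟨ *ₚ-distribˡ g (const c) (0# ∷ f) ⟨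
      g *ₚ (const c +ₚ (0# ∷ f))         ≈⟨ *ₚ-congʳ g (∷-cong (+-identityʳ c) ≈-refl) ⟩
      g *ₚ (c ∷ f)                       ∎
    where open ≈-Reasoning

  *ₚ-congˡ : ∀ {f g} h → f ≈ g → f *ₚ h ≈ g *ₚ h
  *ₚ-congˡ {f} {g} h f≈g = ≈-trans (*ₚ-comm f h) (≈-trans (*ₚ-congʳ h f≈g) (*ₚ-comm h g))

  *ₚ-cong : ∀ {f g h k} → f ≈ g → h ≈ k → f *ₚ h ≈ g *ₚ k
  *ₚ-cong {g = g} {h = h} f≈g h≈k = ≈-trans (*ₚ-congˡ h f≈g) (*ₚ-congʳ g h≈k)

  *ₚ-distribʳ : ∀ h f g → (f +ₚ g) *ₚ h ≈ f *ₚ h +ₚ g *ₚ h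
  *ₚ-distribʳ h f g = begin
      (f +ₚ g) *ₚ h         ≈⟨ *ₚ-comm (f +ₚ g) h ⟩
      h *ₚ (f +ₚ g)         ≈⟨ *ₚ-distribˡ h f g ⟩
      h *ₚ f +ₚ h *ₚ g      ≈⟨ +ₚ-cong (*ₚ-comm h f) (*ₚ-comm h g) ⟩
      f *ₚ h +ₚ g *ₚ h      ∎
    where open ≈-Reasoning

  •-*ₚ : ∀ c f g → (c • f) *ₚ g ≈ c • (f *ₚ g)
  •-*ₚ c []      g = ≈-refl
  •-*ₚ c (d ∷ f) g = begin
      (c * d) • g +ₚ (0# ∷ (c • f) *ₚ g)    ≈⟨ +ₚ-cong (•-assoc c d g) (∷-cong refl (•-*ₚ c f g)) ⟩
      c • (d • g) +ₚ (0# ∷ c • (f *ₚ g))    ≈⟨ +ₚ-cong ≈-refl (•-0∷ c (f *ₚ g)) ⟨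
      c • (d • g) +ₚ c • (0# ∷ f *ₚ g)      ≈⟨ •-distribˡ c (d • g) (0# ∷ f *ₚ g) ⟨
      c • (d • g +ₚ (0# ∷ f *ₚ g))          ∎
    where open ≈-Reasoning

  *ₚ-assoc : ∀ f g h → (f *ₚ g) *ₚ h ≈ f *ₚ (g *ₚ h)
  *ₚ-assoc []      g h = ≈-refl
  *ₚ-assoc (c ∷ f) g h = begin
      (c • g +ₚ (0# ∷ f *ₚ g)) *ₚ h             ≈⟨ *ₚ-distribʳ h (c • g) (0# ∷ f *ₚ g) ⟩
      (c • g) *ₚ h +ₚ (0# ∷ f *ₚ g) *ₚ h        ≈⟨ +ₚ-cong (•-*ₚ c g h) (0∷-*ₚ (f *ₚ g) h) ⟩
      c • (g *ₚ h) +ₚ (0# ∷ (f *ₚ g) *ₚ h)      ≈⟨ +ₚ-cong ≈-refl (∷-cong refl (*ₚ-assoc f g h)) ⟩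
      c • (g *ₚ h) +ₚ (0# ∷ f *ₚ (g *ₚ h))      ∎
    where open ≈-Reasoning

  *ₚ-identityˡ : ∀ f → 1ₚ *ₚ f ≈ f
  *ₚ-identityˡ f = ≈-trans (+ₚ-cong (•-identityˡ f) 0∷0ₚ) (+ₚ-identityʳ f)

  +ₚ-*ₚ-isCommutativeSemiring : IsCommutativeSemiring _≈_ _+ₚ_ _*ₚ_ 0ₚ 1ₚ
  +ₚ-*ₚ-isCommutativeSemiring =
    Biased.IsCommutativeSemiringˡ.isCommutativeSemiring {_≈_ = _≈_} record
    { +-isCommutativeMonoid = +ₚ-isCommutativeMonoid
    ; *-isCommutativeMonoid = Biased.IsCommutativeMonoidˡ.isCommutativeMonoid {_≈_ = _≈_} record
      { isSemigroup = record
        { isMagma = record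
          { isEquivalence = ≈-isEquivalence
          ; ∙-cong = *ₚ-cong
          }
        ; assoc = *ₚ-assoc
        }
      ; identityˡ = *ₚ-identityˡ
      ; comm      = *ₚ-comm
      }
    ; distribʳ = *ₚ-distribʳ
    ; zeroˡ    = λ _ → ≈-refl
    }

  +ₚ-*ₚ-commutativeSemiring : CommutativeSemiring ℓ ℓ
  +ₚ-*ₚ-commutativeSemiring = record { isCommutativeSemiring = +ₚ-*ₚ-isCommutativeSemiring }

  open CommutativeSemiring +ₚ-*ₚ-commutativeSemiring
    using (semiring; *-commutativeSemigroup)
  open CommutativeSemigroupProperties *-commutativeSemigroup
    using ()
    renaming (interchange to *ₚ-interchange; x∙yz≈yx∙z to *ₚ-x∙yz≈yx∙z; x∙yz≈y∙xz to *ₚ-x∙yz≈y∙xz)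
  open SemiringDivisibility semiring public using (_∣_; _,_)
  open SemiringDivisibility semiring using (_∣0; ∣ʳ-refl; ∣ʳ-respʳ-≈; x∣ʳy⇒x∣ʳzy; x∣ʳyx)

  const-*ₚ : ∀ c f → const c *ₚ f ≈ c • f
  const-*ₚ c f = ≈-trans (*ₚ-comm (const c) f) (*ₚ-const f c)

  +ₚ-const-≈0ₚ⇒≈const : ∀ {f c} → f +ₚ const (- c) ≈ 0ₚ → f ≈ const c
  +ₚ-const-≈0ₚ⇒≈const {f} {c} f-c≈0 = begin
      f                                  ≈⟨ +ₚ-identityʳ f ⟨
      f +ₚ 0ₚ                            ≈⟨ +ₚ-cong ≈-refl -c+c≈0 ⟨
      f +ₚ (const (- c) +ₚ const c)      ≈⟨ +ₚ-assoc f (const (- c)) (const c) ⟨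
      (f +ₚ const (- c)) +ₚ const c      ≈⟨ +ₚ-cong f-c≈0 ≈-refl ⟩
      const c                            ∎
    where
    open ≈-Reasoning
    -c+c≈0 : const (- c) +ₚ const c ≈ 0ₚ
    -c+c≈0 = ≈-trans (∷-cong (-‿inverseˡ c) ≈-refl) 0∷0ₚ

  IsUnit-resp-≈ : ∀ {f g} → f ≈ g → IsUnit f → IsUnit g
  IsUnit-resp-≈ {f} {g} f≈g (h , fh≈1) =
    h , coeff-≡ (≈-trans (*ₚ-congˡ h (≈-sym f≈g)) (coeffwise {f *ₚ h} {1ₚ} fh≈1))

  IsUnit-*ₚ : ∀ {f g} → IsUnit f → IsUnit g → IsUnit (f *ₚ g)
  IsUnit-*ₚ {f} {g} (f′ , ff′≈1) (g′ , gg′≈1) = f′ *ₚ g′ , coeff-≡ (begin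
      (f *ₚ g) *ₚ (f′ *ₚ g′)   ≈⟨ *ₚ-interchange f g f′ g′ ⟩
      (f *ₚ f′) *ₚ (g *ₚ g′)   ≈⟨ *ₚ-cong (coeffwise {f *ₚ f′} {1ₚ} ff′≈1) (coeffwise {g *ₚ g′} {1ₚ} gg′≈1) ⟩
      1ₚ *ₚ 1ₚ                 ≈⟨ *ₚ-identityˡ 1ₚ ⟩
      1ₚ                       ∎)
    where open ≈-Reasoning

  ∣-IsUnit : ∀ {f g} → f ∣ g → IsUnit g → IsUnit f
  ∣-IsUnit {f} {g} (q , qf≈g) (h , gh≈1) = q *ₚ h , coeff-≡ (begin
      f *ₚ (q *ₚ h)   ≈⟨ *ₚ-x∙yz≈yx∙z f q h ⟩
      (q *ₚ f) *ₚ h   ≈⟨ *ₚ-congˡ h qf≈g ⟩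
      g *ₚ h          ≈⟨ coeffwise gh≈1 ⟩
      1ₚ              ∎)
    where open ≈-Reasoning

  const-IsUnit : ∀ {c} → c ≢ 0# → IsUnit (const c)
  const-IsUnit {c} c≢0 with inverse c c≢0
  ... | c⁻¹ , cc⁻¹≡1 = const c⁻¹ , coeff-≡ (∷-cong (trans (+-identityʳ (c * c⁻¹)) cc⁻¹≡1) ≈-refl)

  ≈0ₚ? : ∀ f → Dec (f ≈ 0ₚ)
  ≈0ₚ? []      = yes ≈-refl
  ≈0ₚ? (c ∷ f) with c ≟ 0# | ≈0ₚ? f
  ... | yes c≡0 | yes f≈0 = yes (≈-trans (∷-cong c≡0 f≈0) 0∷0ₚ)
  ... | yes _   | no f≉0  = no λ c∷f≈0 → f≉0 (coeffwise λ n → coeff-≡ c∷f≈0 (suc n))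
  ... | no c≢0  | _       = no λ c∷f≈0 → c≢0 (coeff-≡ c∷f≈0 zero)

  DegreeAtMost : A → ℕ → Set ℓ
  DegreeAtMost f d = ∀ m → d ℕ.< m → coeff f m ≡ 0#

  degree : ∀ f → f ≉ 0ₚ → Σ ℕ λ d → coeff f d ≢ 0# × DegreeAtMost f d
  degree []      []≉0  = ⊥-elim ([]≉0 ≈-refl)
  degree (c ∷ f) c∷f≉0 with ≈0ₚ? f
  ... | yes f≈0 =
    0 , (λ c≡0 → c∷f≉0 (≈-trans (∷-cong c≡0 f≈0) 0∷0ₚ)) , λ { (suc m) _ → coeff-≡ f≈0 m }
  ... | no f≉0 with degree f f≉0
  ...   | d , lc≢0 , f≤d = suc d , lc≢0 , λ { (suc m) (s≤s d<m) → f≤d m d<m }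

  coeff-*ₚ-top : ∀ f g {d e} → DegreeAtMost f d → DegreeAtMost g e →
                 coeff (f *ₚ g) (d ℕ.+ e) ≡ coeff f d * coeff g e
  coeff-*ₚ-top []      g         f≤d g≤e = sym (zeroˡ _)
  coeff-*ₚ-top (c ∷ f) g {zero}  {e} f≤0 g≤e = begin
      coeff (c • g +ₚ (0# ∷ f *ₚ g)) e          ≡⟨ coeff-+ₚ (c • g) (0# ∷ f *ₚ g) e ⟩
      coeff (c • g) e + coeff (0# ∷ f *ₚ g) e   ≡⟨ cong₂ _+_ (coeff-• c g e) (coeff-≡ 0∷fg≈0 e) ⟩
      c * coeff g e + 0#                        ≡⟨ +-identityʳ _ ⟩
      c * coeff g e                             ∎
    where
    open ≡-Reasoning
    0∷fg≈0 : 0# ∷ f *ₚ g ≈ 0ₚ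
    0∷fg≈0 = ≈-trans (∷-cong refl (*ₚ-congˡ g f≈0)) 0∷0ₚ
      where
      f≈0 : f ≈ 0ₚ
      f≈0 = coeffwise λ m → f≤0 (suc m) (s≤s z≤n)
  coeff-*ₚ-top (c ∷ f) g {suc d} {e} f≤d g≤e = begin
      coeff (c • g +ₚ (0# ∷ f *ₚ g)) (suc (d ℕ.+ e))
        ≡⟨ coeff-+ₚ (c • g) (0# ∷ f *ₚ g) (suc (d ℕ.+ e)) ⟩
      coeff (c • g) (suc (d ℕ.+ e)) + coeff (f *ₚ g) (d ℕ.+ e)
        ≡⟨ cong₂ _+_ cg-vanishes (coeff-*ₚ-top f g f′≤d g≤e) ⟩
      0# + coeff f d * coeff g e
        ≡⟨ +-identityˡ _ ⟩
      coeff f d * coeff g e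
        ∎
    where
    open ≡-Reasoning
    f′≤d : DegreeAtMost f d
    f′≤d m d<m = f≤d (suc m) (s≤s d<m)
    cg-vanishes : coeff (c • g) (suc (d ℕ.+ e)) ≡ 0#
    cg-vanishes = trans (coeff-• c g _) (trans (cong (c *_) (g≤e _ (s≤s (m≤n+m e d)))) (zeroʳ c))

  *ₚ≈1ₚ⇒≉0ₚ : ∀ {f g} → f *ₚ g ≈ 1ₚ → f ≉ 0ₚ
  *ₚ≈1ₚ⇒≉0ₚ {f} {g} fg≈1 f≈0 = 0≢1 (trans (sym (coeff-≡ (*ₚ-congˡ g f≈0) 0)) (coeff-≡ fg≈1 0))

  IsUnit⇒InFqˣ : ∀ {f} → IsUnit f → InFqˣ f
  IsUnit⇒InFqˣ {f} (g , fg≈1) with degree f (*ₚ≈1ₚ⇒≉0ₚ (coeffwise fg≈1))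
                                 | degree g (*ₚ≈1ₚ⇒≉0ₚ (≈-trans (*ₚ-comm g f) (coeffwise fg≈1)))
  ... | zero , c≢0 , f≤0 | _ = coeff f 0 , c≢0 , λ { zero → refl ; (suc m) → f≤0 (suc m) (s≤s z≤n) }
  ... | suc d , lc≢0 , f≤d | e , lc′≢0 , g≤e = ⊥-elim (*-nonZero lc≢0 lc′≢0 (begin
      coeff f (suc d) * coeff g e       ≡⟨ coeff-*ₚ-top f g f≤d g≤e ⟨
      coeff (f *ₚ g) (suc (d ℕ.+ e))    ≡⟨ fg≈1 (suc (d ℕ.+ e)) ⟩
      0#                                ∎))
    where open ≡-Reasoning

  Irreducible-associate : ∀ {u x f} → IsUnit u → u *ₚ x ≈ f → Irreducible f → Irreducible x
  Irreducible-associate {u} {x} {f} u-unit ux≈f (f≉0 , f-nonunit , f-split) =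
    x≉0 , x-nonunit , x-split
    where
    open ≈-Reasoning
    x≉0 : ¬ (x ≈ₚ 0ₚ)
    x≉0 x≈0 = f≉0 (coeff-≡ (begin
      f          ≈⟨ ux≈f ⟨
      u *ₚ x     ≈⟨ *ₚ-congʳ u (coeffwise x≈0) ⟩
      u *ₚ 0ₚ    ≈⟨ *ₚ-zeroʳ u ⟩
      0ₚ         ∎))
    x-nonunit : ¬ IsUnit x
    x-nonunit x-unit = f-nonunit (IsUnit-resp-≈ ux≈f (IsUnit-*ₚ {u} {x} u-unit x-unit))
    x-split : ∀ g h → x ≈ₚ g *ₚ h → IsUnit g ⊎ IsUnit h
    x-split g h x≈gh = map₂ (∣-IsUnit (x∣ʳyx h u)) (f-split g (u *ₚ h) (coeff-≡ (begin
      f                 ≈⟨ ux≈f ⟨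
      u *ₚ x            ≈⟨ *ₚ-congʳ u (coeffwise x≈gh) ⟩
      u *ₚ (g *ₚ h)     ≈⟨ *ₚ-x∙yz≈y∙xz u g h ⟩
      g *ₚ (u *ₚ h)     ∎)))

  ∣-+ₚ : ∀ {f g h} → f ∣ g → f ∣ h → f ∣ g +ₚ h
  ∣-+ₚ {f} (a , af≈g) (b , bf≈h) = a +ₚ b , ≈-trans (*ₚ-distribʳ f a b) (+ₚ-cong af≈g bf≈h)

  ∣-• : ∀ {f g} c → f ∣ g → f ∣ c • g
  ∣-• {g = g} c f∣g = ∣ʳ-respʳ-≈ (const-*ₚ c g) (x∣ʳy⇒x∣ʳzy (const c) f∣g)

  ∣-^ₚ : ∀ {f g} n .{{_ : NonZero n}} → f ∣ g → f ∣ g ^ₚ n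
  ∣-^ₚ {g = g} (suc n) f∣g = ∣ʳ-respʳ-≈ (*ₚ-comm (g ^ₚ n) g) (x∣ʳy⇒x∣ʳzy (g ^ₚ n) f∣g)

  module DrinfeldModuleProperties (D : DrinfeldModule) where
    open DrinfeldModule D

    ∣-tail : ∀ {x y} n → x ∣ y → x ∣ tail n y
    ∣-tail zero    x∣y = _ ∣0
    ∣-tail (suc n) x∣y =
      ∣-+ₚ (∣-tail n x∣y) (x∣ʳy⇒x∣ʳzy (a (suc n)) (∣-^ₚ (q ℕ.^ suc n) {{q^n-nonZero (suc n)}} x∣y))

    ∣-φθ : ∀ {x y} → x ∣ y → x ∣ φθ y
    ∣-φθ x∣y = ∣-+ₚ (x∣ʳy⇒x∣ʳzy θ x∣y) (∣-tail r x∣y)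

    ∣-φ : ∀ {x y} b → x ∣ y → x ∣ φ b y
    ∣-φ []      x∣y = _ ∣0
    ∣-φ (c ∷ b) x∣y = ∣-+ₚ (∣-• c x∣y) (∣-φ b (∣-φθ x∣y))

    x∣φ[b]x : ∀ b x → x ∣ φ b x
    x∣φ[b]x b x = ∣-φ b ∣ʳ-refl

    φ-+ₚ : ∀ b b′ y → φ (b +ₚ b′) y ≈ φ b y +ₚ φ b′ y
    φ-+ₚ []      b′       y = ≈-refl
    φ-+ₚ (c ∷ b) []       y = ≈-sym (+ₚ-identityʳ (φ (c ∷ b) y))
    φ-+ₚ (c ∷ b) (d ∷ b′) y = begin
        (c + d) • y +ₚ φ (b +ₚ b′) (φθ y)
          ≈⟨ +ₚ-cong (•-distribʳ c d y) (φ-+ₚ b b′ (φθ y)) ⟩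
        (c • y +ₚ d • y) +ₚ (φ b (φθ y) +ₚ φ b′ (φθ y))
          ≈⟨ +ₚ-interchange (c • y) (d • y) (φ b (φθ y)) (φ b′ (φθ y)) ⟩
        (c • y +ₚ φ b (φθ y)) +ₚ (d • y +ₚ φ b′ (φθ y))
          ∎
      where open ≈-Reasoning

    φ-const : ∀ c y → φ (const c) y ≈ c • y
    φ-const c y = +ₚ-identityʳ (c • y)

    unit-multiple⇒Torsion : ∀ {u x b} → IsUnit u → u *ₚ x ≈ φ b x → ¬ IsUnit b → Torsion x
    unit-multiple⇒Torsion {u} {x} {b} u-unit ux≈φbx b-nonunit with IsUnit⇒InFqˣ {u} u-unit
    ... | c , c≢0 , u≈c = b +ₚ const (- c) , b-c≉0 , coeff-≡ φ[b-c]x≈0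
      where
      open ≈-Reasoning
      b-c≉0 : ¬ (b +ₚ const (- c) ≈ₚ 0ₚ)
      b-c≉0 b-c≈0 = b-nonunit (IsUnit-resp-≈ (≈-sym b≈c) (const-IsUnit c≢0))
        where
        b≈c : b ≈ const c
        b≈c = +ₚ-const-≈0ₚ⇒≈const (coeffwise {b +ₚ const (- c)} {0ₚ} b-c≈0)
      φ[b-c]x≈0 : φ (b +ₚ const (- c)) x ≈ 0ₚ
      φ[b-c]x≈0 = begin
        φ (b +ₚ const (- c)) x         ≈⟨ φ-+ₚ b (const (- c)) x ⟩
        φ b x +ₚ φ (const (- c)) x     ≈⟨ +ₚ-cong (≈-sym ux≈φbx) (φ-const (- c) x) ⟩
        u *ₚ x +ₚ (- c) • x            ≈⟨ +ₚ-cong (*ₚ-congˡ x (coeffwise {u} {const c} u≈c)) ≈-refl ⟩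
        const c *ₚ x +ₚ (- c) • x      ≈⟨ +ₚ-cong (const-*ₚ c x) ≈-refl ⟩
        c • x +ₚ (- c) • x             ≈⟨ •-distribʳ c (- c) x ⟨
        (c + - c) • x                  ≡⟨ cong (_• x) (-‿inverseʳ c) ⟩
        0# • x                         ≈⟨ •-zeroˡ x ⟩
        0ₚ                             ∎

mainTheorem11 : ∀ {ℓ : Level} (F : FiniteField ℓ) → let open Poly F in
    (D : DrinfeldModule) → let open DrinfeldModule D in
    (x P : A) → Irreducible P → Irreducible (φ P x) →
    (Irreducible x × Torsion x) ⊎ InFqˣ x
mainTheorem11 F D x P (_ , P-nonunit , _) φPx-irreducible@(_ , _ , φPx-split) =
  conclude (x∣φ[b]x P x)
  where
  open Poly F
  open DrinfeldModule D
  open PolynomialRing F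
  open DrinfeldModuleProperties D
  conclude : x ∣ φ P x → (Irreducible x × Torsion x) ⊎ InFqˣ x
  conclude (u , ux≈φPx) with φPx-split u x (coeff-≡ (≈-sym ux≈φPx))
  ... | inj₁ u-unit = inj₁ ( Irreducible-associate {u} {x} u-unit ux≈φPx φPx-irreducible
                           , unit-multiple⇒Torsion {u} {x} {P} u-unit ux≈φPx P-nonunit)
  ... | inj₂ x-unit = inj₂ (IsUnit⇒InFqˣ {x} x-unit)
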